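{- Let $Z=[\tau_1,\tau_2,\tau_3]$ be a bicyclic bitrade. Then there is no spherical bitrade $X$, point $x$ and direction $j\in\{1,2,3\}$ such that the slide expansion $\mathrm{slide}(X,x,j)$ is defined and $\mathrm{slide}(X,x,j)=Z$ or $\mathrm{slide}(X,x,j)=Z^{ -1}$, where $Z^{ -1}=[\tau_1^{ -1},\tau_2^{ -1},\tau_2\tau_1]$.
   Context: Permutations act on the right ($x\mapsto x\pi$) and are composed left to right. A bitrade (in $\tau$-representation) is a triple $[\tau_1,\tau_2,\tau_3]$ of permutations of a finite set $\Gamma=\mathrm{mov}(\tau_1)\cup\mathrm{mov}(\tau_2)\cup\mathrm{mov}(\tau_3)$ (where $\mathrm{mov}(\pi)$ is the set of points moved by $\pi$) satisfying: (T1) $\tau_1\tau_2\tau_3=1$; (T2) for $1\le i<j\le 3$, any cycle of $\tau_i$ and any cycle of $\tau_j$ share at most one point; (T3) each $\tau_i$ is fixed-point-free. It is spherical if the total number of cycles of $\tau_1,\tau_2,\tau_3$ equals $|\Gamma|+2$ (genus $0$). It is bicyclic if some $\tau_j$ consists of exactly two cycles. Slide expansion: let $X=[\tau_1,\tau_2,\tau_3]$ be a spherical bitrade on $\Gamma$, $x\in\Gamma$, $j\in\{1,2,3\}$, $k=j+1$, $l=k+1$ (indices mod 3), $w=x\tau_j$. If (1) the cycle of $\tau_j$ through $x$ has length at least $3$ and (2) the cycle of $\tau_k$ through $x$ and the cycle of $\tau_l$ through $w$ have no common point, then $\mathrm{slide}(X,x,j)$ is the triple on $\Gamma\cup\{u\}$,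 $u\notin\Gamma$ a new point, obtained by: replacing the $\tau_j$-cycle $(a,x,w,b,\dots)$ by the two cycles $(a,u,b,\dots)$ and $(x,w)$; replacing the $\tau_k$-cycle $(\dots,x,z,\dots)$ by $(\dots,x,u,z,\dots)$; replacing the $\tau_l$-cycle $(\dots,y,w,\dots)$ by $(\dots,y,u,w,\dots)$; all other cycles unchanged. -}

module Defs where

open import Data.Nat.Base using (ℕ; zero; suc; _≤_; _<_; _+_; _≤ᵇ_)
open import Data.Fin.Base using (Fin; toℕ; punchIn; punchOut)
open import Data.Fin.Patterns using (0F; 1F; 2F)
open import Data.Fin.Properties using (_≟_)
open import Data.Fin.Permutation using (Permutation′; _⟨$⟩ʳ_; _⟨$⟩ˡ_)
open import Data.List.Base using (List; upTo; allFin; map)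
open import Data.Nat.ListAction using (sum)
open import Data.Bool.ListAction using (all)
open import Data.Bool.Base using (Bool; if_then_else_)
open import Data.Product.Base using (Σ; ∃; _×_; _,_)
open import Relation.Nullary using (¬_; yes; no; does)
open import Relation.Binary.PropositionalEquality using (_≡_; _≢_)

-- The image "x π" of the
-- paper (right action) is written  π ⟨$⟩ʳ x .  Composition is left to
-- right: x(π σ) = (x π) σ.

iter : ∀ {n} → Permutation′ n → ℕ → Fin n → Fin n
iter π zero    a = a
iter π (suc m) a = iter π m (π ⟨$⟩ʳ a)

SameCycle : ∀ {n} → Permutation′ n → Fin n → Fin n → Set
SameCycle π a b = ∃ λ m → iter π m a ≡ b

IsCycleLength : ∀ {n} → Permutation′ n → Fin n → ℕ → Set
IsCycleLength π a m =
  (1 ≤ m) × (iter π m a ≡ a) × (∀ k → 1 ≤ k → k < m → iter π k a ≢ a)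

-- a is the least element (in the order of Fin n) of its π-cycle; the
-- cycle of a is {a π^m | m < n}.
isCycleRep : ∀ {n} → Permutation′ n → Fin n → Bool
isCycleRep {n} π a = all (λ m → toℕ a ≤ᵇ toℕ (iter π m a)) (upTo n)

numCycles : ∀ {n} → Permutation′ n → ℕ
numCycles {n} π = sum (map (λ a → if isCycleRep π a then 1 else 0) (allFin n))

-- A triple [τ₁, τ₂, τ₃] is indexed by Fin 3: τ 0F = τ₁, τ 1F = τ₂, τ 2F = τ₃.
Triple : ℕ → Set
Triple n = Fin 3 → Permutation′ n

-- Bitrade on Γ = Fin n.  Since each τᵢ is fixed-point-free, the union
-- of the moved points is all of Fin n, as required for Γ.
record IsBitrade {n : ℕ} (τ : Triple n) : Set where
  field
    T1 : ∀ a → τ 2F ⟨$⟩ʳ (τ 1F ⟨$⟩ʳ (τ 0F ⟨$⟩ʳ a)) ≡ a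
    T2 : ∀ i j → i ≢ j → ∀ a b →
         SameCycle (τ i) a b → SameCycle (τ j) a b → a ≡ b
    T3 : ∀ i a → τ i ⟨$⟩ʳ a ≢ a

IsSpherical : ∀ {n} → Triple n → Set
IsSpherical {n} τ =
  numCycles (τ 0F) + numCycles (τ 1F) + numCycles (τ 2F) ≡ n + 2

IsBicyclic : ∀ {n} → Triple n → Set
IsBicyclic τ = ∃ λ j → numCycles (τ j) ≡ 2

next : Fin 3 → Fin 3
next 0F = 1F
next 1F = 2F
next 2F = 0F

SlideDefined : ∀ {n} → Triple n → Fin n → Fin 3 → Set
SlideDefined τ x j =
  (∃ λ m → IsCycleLength (τ j) x m × (3 ≤ m)) ×
  ¬ (∃ λ p → SameCycle (τ (next j)) x p
             × SameCycle (τ (next (next j))) (τ j ⟨$⟩ʳ x) p)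

-- Extend a map on the old points (identified with Fin (suc n) minus u
-- via punchIn u) by a value at the new point u.
extend : ∀ {n} → (u : Fin (suc n)) → (Fin n → Fin (suc n)) → Fin (suc n) →
         Fin (suc n) → Fin (suc n)
extend u f fu p with u ≟ p
... | yes _  = fu
... | no u≢p = f (punchOut u≢p)

ifEq : ∀ {n} {A : Set} → Fin n → Fin n → A → A → A
ifEq q r s t = if does (q ≟ r) then s else t

-- slide(X, x, j) as a triple of maps on Γ ∪ {u} = Fin (suc n), where the
-- old point q ∈ Γ = Fin n is identified with punchIn u q.
slide : ∀ {n} → Triple n → Fin n → Fin 3 → (u : Fin (suc n)) →
        Fin 3 → Fin (suc n) → Fin (suc n)
slide τ x j u i =
  ifEq i j τj′ (ifEq i (next j) τk′ τl′)
  where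
    ι = punchIn u
    τj = τ j
    τk = τ (next j)
    τl = τ (next (next j))
    w = τj ⟨$⟩ʳ x
    a = τj ⟨$⟩ˡ x
    b = τj ⟨$⟩ʳ w
    y = τl ⟨$⟩ˡ w
    -- (a, x, w, b, …) ↦ (a, u, b, …)(x, w)
    τj′ = extend u (λ q → ifEq q a u (ifEq q x (ι w) (ifEq q w (ι x) (ι (τj ⟨$⟩ʳ q)))))
                   (ι b)
    -- (…, x, z, …) ↦ (…, x, u, z, …)
    τk′ = extend u (λ q → ifEq q x u (ι (τk ⟨$⟩ʳ q))) (ι (τk ⟨$⟩ʳ x))
    -- (…, y, w, …) ↦ (…, y, u, w, …)
    τl′ = extend u (λ q → ifEq q y u (ι (τl ⟨$⟩ʳ q))) (ι w)

-- Z⁻¹ = [τ₁⁻¹, τ₂⁻¹, τ₂τ₁] as maps (τ₂τ₁ composed left to right)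
inverseTriple : ∀ {n} → Triple n → Fin 3 → Fin n → Fin n
inverseTriple τ 0F a = τ 0F ⟨$⟩ˡ a
inverseTriple τ 1F a = τ 1F ⟨$⟩ˡ a
inverseTriple τ 2F a = τ 0F ⟨$⟩ʳ (τ 1F ⟨$⟩ʳ a)

asMaps : ∀ {n} → Triple n → Fin 3 → Fin n → Fin n
asMaps τ i a = τ i ⟨$⟩ʳ a

_≐_ : ∀ {n} → (Fin 3 → Fin n → Fin n) → (Fin 3 → Fin n → Fin n) → Set
σ ≐ ρ = ∀ i a → σ i a ≡ ρ i a

module Submission where

-- If τᵢ has only two cycles, every other component τₜ (t ≠ i) of
-- a bitrade is an involution: otherwise p, pτₜ, pτₜ² would be three
-- points in pairwise different τᵢ-cycles (distinct τᵢ-cycles by (T2)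
-- and (T3)), forcing at least three τᵢ-cycles.  The same then holds for
-- the inverse triple Z⁻¹.  On the other hand, in slide(X, x, j) the new
-- point u lies on a cycle of length ≥ 3 in both components k, l ≠ j:
-- u ↦ xτₖ ↦ xτₖ² and u ↦ w ↦ wτₗ, and neither second image is u.
-- Since some index t differs from both i and j, the t-th components of
-- slide(X, x, j) and of Z (or Z⁻¹) cannot agree.

open import Defs
open import Data.Nat.Base using (ℕ; zero; suc; _+_; _*_; _≤_; _<_; _≤ᵇ_; s≤s)
open import Data.Nat.Properties using (≤⇒≤ᵇ; ≰⇒>; +-comm; +-suc; +-commutativeSemigroup; *-suc; m≤m+n; ≤-trans; ≤-reflexive; +-monoʳ-≤; m≤n⇒∃[o]m+o≡n)
open import Algebra.Properties.CommutativeSemigroup +-commutativeSemigroup using (x∙yz≈y∙xz)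
open import Data.Fin.Base using (Fin; toℕ; punchIn; punchOut)
import Data.Fin.Base as Fin
open import Data.Fin.Patterns using (0F; 1F; 2F)
open import Data.Fin.Properties using (_≟_; toℕ<n; pigeonhole; punchInᵢ≢i; punchOut-punchIn; punchIn-punchOut; punchOut-injective; punchOut-cong)
open import Data.Fin.Permutation using (Permutation′; _⟨$⟩ʳ_; _⟨$⟩ˡ_; inverseʳ; inverseˡ)
open import Data.List.Base using ([]; _∷_; upTo; tabulate)
open import Data.List.Properties using (map-tabulate)
open import Data.Nat.ListAction using (sum)
open import Data.Bool.ListAction using (all)
open import Data.Bool.Base using (Bool; true; false; T; if_then_else_)
open import Data.Product.Base using (_×_; _,_; proj₁; proj₂; ∃)
open import Data.Sum.Base using (_⊎_; inj₁; inj₂)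
open import Data.Empty using (⊥-elim)
open import Relation.Nullary using (¬_; yes; no)
open import Relation.Binary.PropositionalEquality
open import Function.Base using (_∘_; id)

iter-+ : ∀ {n} (π : Permutation′ n) m k a → iter π (m + k) a ≡ iter π k (iter π m a)
iter-+ π zero    k a = refl
iter-+ π (suc m) k a = iter-+ π m k (π ⟨$⟩ʳ a)

iter-injective : ∀ {n} (π : Permutation′ n) m {a b} → iter π m a ≡ iter π m b → a ≡ b
iter-injective π zero    e = e
iter-injective π (suc m) {a} {b} e = begin
  a                         ≡⟨ inverseˡ π ⟨
  π ⟨$⟩ˡ (π ⟨$⟩ʳ a)          ≡⟨ cong (π ⟨$⟩ˡ_) (iter-injective π m e) ⟩
  π ⟨$⟩ˡ (π ⟨$⟩ʳ b)          ≡⟨ inverseˡ π ⟩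
  b                         ∎
  where open ≡-Reasoning

-- Every point returns to itself: among a, aπ, …, aπⁿ two coincide.
returns : ∀ {n} (π : Permutation′ n) a → ∃ λ d → iter π (suc d) a ≡ a
returns {n} π a with pigeonhole (s≤s (≤-reflexive refl)) (λ (i : Fin (suc n)) → iter π (toℕ i) a)
... | i , j , i<j , same with m≤n⇒∃[o]m+o≡n i<j
... | d , i+d+1≡j = d , iter-injective π (toℕ i) (begin
  iter π (toℕ i) (iter π (suc d) a)  ≡⟨ iter-+ π (suc d) (toℕ i) a ⟨
  iter π (suc d + toℕ i) a           ≡⟨ cong (λ m → iter π m a) (trans (+-comm (suc d) (toℕ i)) (trans (+-suc (toℕ i) d) i+d+1≡j)) ⟩
  iter π (toℕ j) a                   ≡⟨ same ⟨
  iter π (toℕ i) a                   ∎)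
  where open ≡-Reasoning

iter-periodic : ∀ {n} (π : Permutation′ n) p a → iter π p a ≡ a → ∀ k → iter π (k * p) a ≡ a
iter-periodic π p a e zero    = refl
iter-periodic π p a e (suc k) =
  trans (iter-+ π p (k * p) a) (trans (cong (iter π (k * p)) e) (iter-periodic π p a e k))

-- The cycle relation is symmetric, since every point returns to itself.
sameCycle-sym : ∀ {n} (π : Permutation′ n) {a b} → SameCycle π a b → SameCycle π b a
sameCycle-sym π {a} (m , refl) with returns π a
... | d , back = m * d , (begin
  iter π (m * d) (iter π m a)  ≡⟨ iter-+ π m (m * d) a ⟨
  iter π (m + m * d) a         ≡⟨ cong (λ k → iter π k a) (*-suc m d) ⟨
  iter π (m * suc d) a         ≡⟨ iter-periodic π (suc d) a back m ⟩
  a                            ∎)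
  where open ≡-Reasoning

sameCycle-trans : ∀ {n} (π : Permutation′ n) {a b c} → SameCycle π a b → SameCycle π b c → SameCycle π a c
sameCycle-trans π {a} (m , refl) (k , refl) = m + k , iter-+ π m k a

not-all : ∀ {A : Set} (g : A → Bool) xs → all g xs ≡ false → ∃ λ x → g x ≡ false
not-all g []       ()
not-all g (x ∷ xs) e with g x in gx
... | false = x , gx
... | true  = not-all g xs e

≤ᵇ-false : ∀ a b → (a ≤ᵇ b) ≡ false → b < a
≤ᵇ-false a b e = ≰⇒> λ a≤b → subst T e (≤⇒≤ᵇ a≤b)

representative-below : ∀ {n} (π : Permutation′ n) k p → toℕ p < k →
  ∃ λ c → isCycleRep π c ≡ true × SameCycle π p c
representative-below {n} π (suc k) p (s≤s p≤k) with isCycleRep π p in isRep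
... | true  = p , isRep , (0 , refl)
... | false with not-all (λ m → toℕ p ≤ᵇ toℕ (iter π m p)) (upTo n) isRep
... | m , smaller with representative-below π k (iter π m p) (≤-trans (≤ᵇ-false _ _ smaller) p≤k)
... | c , cRep , toC = c , cRep , sameCycle-trans π (m , refl) toC

representative : ∀ {n} (π : Permutation′ n) p → ∃ λ c → isCycleRep π c ≡ true × SameCycle π p c
representative π p = representative-below π _ p (toℕ<n p)

rep : ∀ {n} → Permutation′ n → Fin n → Fin n
rep π p = proj₁ (representative π p)

same-rep⇒sameCycle : ∀ {n} (π : Permutation′ n) a b → rep π a ≡ rep π b → SameCycle π a b
same-rep⇒sameCycle π a b e with representative π a | representative π b
... | c , _ , a~c | d , _ , b~d =
  sameCycle-trans π a~c (subst (λ z → SameCycle π z b) (sym e) (sameCycle-sym π b~d))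

sum-remove : ∀ {m} (f : Fin (suc m) → ℕ) a →
  sum (tabulate f) ≡ f a + sum (tabulate (f ∘ punchIn a))
sum-remove f Fin.zero = refl
sum-remove {suc m} f (Fin.suc a) =
  trans (cong (f 0F +_) (sum-remove (f ∘ Fin.suc) a))
        (x∙yz≈y∙xz (f 0F) (f (Fin.suc a)) _)

sum-single : ∀ {m} (f : Fin m → ℕ) a → f a ≤ sum (tabulate f)
sum-single {suc m} f a = subst (f a ≤_) (sym (sum-remove f a)) (m≤m+n (f a) _)

sum-pair : ∀ {m} (f : Fin m → ℕ) {a b} → a ≢ b → f a + f b ≤ sum (tabulate f)
sum-pair {suc m} f {a} {b} a≢b = subst (f a + f b ≤_) (sym (sum-remove f a))
  (+-monoʳ-≤ (f a) (subst (_≤ sum (tabulate rest)) (cong f (punchIn-punchOut a≢b))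
                          (sum-single rest (punchOut a≢b))))
  where
  rest : Fin m → ℕ
  rest = f ∘ punchIn a

sum-triple : ∀ {m} (f : Fin m → ℕ) {a b c} → a ≢ b → a ≢ c → b ≢ c →
  f a + (f b + f c) ≤ sum (tabulate f)
sum-triple {suc m} f {a} {b} {c} a≢b a≢c b≢c = subst (f a + (f b + f c) ≤_) (sym (sum-remove f a))
  (+-monoʳ-≤ (f a) (subst₂ (λ x y → x + y ≤ sum (tabulate rest))
                           (cong f (punchIn-punchOut a≢b)) (cong f (punchIn-punchOut a≢c))
                           (sum-pair rest (b≢c ∘ punchOut-injective a≢b a≢c))))
  where
  rest : Fin m → ℕ
  rest = f ∘ punchIn a

numCycles≥3 : ∀ {n} (π : Permutation′ n) {a b c} →
  ¬ SameCycle π a b → ¬ SameCycle π a c → ¬ SameCycle π b c → 3 ≤ numCycles π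
numCycles≥3 {n} π {a} {b} {c} a≁b a≁c b≁c =
  subst₂ _≤_ (cong₂ _+_ (counted a) (cong₂ _+_ (counted b) (counted c)))
             (sym (cong sum (map-tabulate id indicator)))
    (sum-triple indicator (a≁b ∘ same-rep⇒sameCycle π a b) (a≁c ∘ same-rep⇒sameCycle π a c)
                          (b≁c ∘ same-rep⇒sameCycle π b c))
  where
  indicator : Fin n → ℕ
  indicator p = if isCycleRep π p then 1 else 0
  counted : ∀ p → indicator (rep π p) ≡ 1
  counted p rewrite proj₁ (proj₂ (representative π p)) = refl

Involution : ∀ {m} → (Fin m → Fin m) → Set
Involution f = ∀ p → f (f p) ≡ p

-- If the cycles of σ and τ meet in at most one point, τ has no fixed
-- points and σ has at most two cycles, then τ is an involution: else
-- p, pτ, pτ² lie on three different σ-cycles.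
few-cycles⇒involution : ∀ {n} (σ τ : Permutation′ n) →
  (∀ a b → SameCycle σ a b → SameCycle τ a b → a ≡ b) → (∀ a → τ ⟨$⟩ʳ a ≢ a) →
  numCycles σ ≤ 2 → Involution (τ ⟨$⟩ʳ_)
few-cycles⇒involution σ τ meet fixfree atMost2 p with τ ⟨$⟩ʳ (τ ⟨$⟩ʳ p) ≟ p
... | yes back = back
... | no ¬back = ⊥-elim (impossible (≤-trans (numCycles≥3 σ p≁q p≁r q≁r) atMost2))
  where
  q = τ ⟨$⟩ʳ p
  r = τ ⟨$⟩ʳ q
  p≁q : ¬ SameCycle σ p q
  p≁q p~q = fixfree p (sym (meet p q p~q (1 , refl)))
  q≁r : ¬ SameCycle σ q r
  q≁r q~r = fixfree q (sym (meet q r q~r (1 , refl)))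
  p≁r : ¬ SameCycle σ p r
  p≁r p~r = ¬back (sym (meet p r p~r (2 , refl)))
  impossible : ¬ (3 ≤ 2)
  impossible (s≤s (s≤s ()))

bicyclic⇒involutions : ∀ {n} (Z : Triple n) → IsBitrade Z → ∀ i → numCycles (Z i) ≤ 2 →
  ∀ t → t ≢ i → Involution (asMaps Z t)
bicyclic⇒involutions Z bZ i atMost2 t t≢i =
  few-cycles⇒involution (Z i) (Z t) (T2 i t (t≢i ∘ sym)) (T3 t) atMost2
  where open IsBitrade bZ

involution⇒inverse : ∀ {n} (π : Permutation′ n) → Involution (π ⟨$⟩ʳ_) → ∀ p → π ⟨$⟩ˡ p ≡ π ⟨$⟩ʳ p
involution⇒inverse π invol p =
  trans (cong (π ⟨$⟩ˡ_) (sym (invol p))) (inverseˡ π)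

-- A component of Z⁻¹ is an involution whenever the corresponding
-- component of Z is: τ₁⁻¹ and τ₂⁻¹ coincide with τ₁, τ₂, and for τ₂τ₁
-- one uses τ₁τ₂ = τ₃⁻¹ = τ₃ and τ₂τ₃ = τ₁⁻¹, both from (T1).
inverseTriple-involution : ∀ {n} (Z : Triple n) → IsBitrade Z →
  ∀ t → Involution (asMaps Z t) → Involution (inverseTriple Z t)
inverseTriple-involution Z bZ 0F invol p
  rewrite involution⇒inverse (Z 0F) invol p | involution⇒inverse (Z 0F) invol (Z 0F ⟨$⟩ʳ p) = invol p
inverseTriple-involution Z bZ 1F invol p
  rewrite involution⇒inverse (Z 1F) invol p | involution⇒inverse (Z 1F) invol (Z 1F ⟨$⟩ʳ p) = invol p
inverseTriple-involution Z bZ 2F invol p = begin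
  Z 0F ⟨$⟩ʳ (Z 1F ⟨$⟩ʳ (Z 0F ⟨$⟩ʳ (Z 1F ⟨$⟩ʳ p)))  ≡⟨ cong (Z 0F ⟨$⟩ʳ_) (τ₁τ₂≡τ₃ (Z 1F ⟨$⟩ʳ p)) ⟩
  Z 0F ⟨$⟩ʳ (Z 2F ⟨$⟩ʳ (Z 1F ⟨$⟩ʳ p))              ≡⟨ cong (Z 0F ⟨$⟩ʳ_) τ₂τ₃≡τ₁⁻¹ ⟩
  Z 0F ⟨$⟩ʳ (Z 0F ⟨$⟩ˡ p)                          ≡⟨ inverseʳ (Z 0F) ⟩
  p                                               ∎
  where
  open IsBitrade bZ
  open ≡-Reasoning
  τ₁τ₂≡τ₃ : ∀ c → Z 1F ⟨$⟩ʳ (Z 0F ⟨$⟩ʳ c) ≡ Z 2F ⟨$⟩ʳ c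
  τ₁τ₂≡τ₃ c = trans (sym (invol _)) (cong (Z 2F ⟨$⟩ʳ_) (T1 c))
  τ₂τ₃≡τ₁⁻¹ : Z 2F ⟨$⟩ʳ (Z 1F ⟨$⟩ʳ p) ≡ Z 0F ⟨$⟩ˡ p
  τ₂τ₃≡τ₁⁻¹ = trans (cong (λ z → Z 2F ⟨$⟩ʳ (Z 1F ⟨$⟩ʳ z)) (sym (inverseʳ (Z 0F)))) (T1 _)

extend-new : ∀ {n} (u : Fin (suc n)) (f : Fin n → Fin (suc n)) fu → extend u f fu u ≡ fu
extend-new u f fu with u ≟ u
... | yes _   = refl
... | no u≢u = ⊥-elim (u≢u refl)

extend-old : ∀ {n} (u : Fin (suc n)) (f : Fin n → Fin (suc n)) fu q → extend u f fu (punchIn u q) ≡ f q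
extend-old u f fu q with u ≟ punchIn u q
... | yes u≡q = ⊥-elim (punchInᵢ≢i u q (sym u≡q))
... | no u≢q  = cong f (trans (punchOut-cong u refl) (punchOut-punchIn u))

ifEq-no : ∀ {n} {A : Set} {q r : Fin n} {s t : A} → q ≢ r → ifEq q r s t ≡ t
ifEq-no {q = q} {r} q≢r with q ≟ r
... | yes q≡r = ⊥-elim (q≢r q≡r)
... | no _    = refl

slide-next : ∀ {n} (X : Triple n) x j u p → slide X x j u (next j) p ≡
  extend u (λ q → ifEq q x u (punchIn u (X (next j) ⟨$⟩ʳ q))) (punchIn u (X (next j) ⟨$⟩ʳ x)) p
slide-next X x 0F u p = refl
slide-next X x 1F u p = refl
slide-next X x 2F u p = refl

slide-prev : ∀ {n} (X : Triple n) x j u p → slide X x j u (next (next j)) p ≡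
  extend u (λ q → ifEq q (X (next (next j)) ⟨$⟩ˡ (X j ⟨$⟩ʳ x)) u (punchIn u (X (next (next j)) ⟨$⟩ʳ q)))
           (punchIn u (X j ⟨$⟩ʳ x)) p
slide-prev X x 0F u p = refl
slide-prev X x 1F u p = refl
slide-prev X x 2F u p = refl

leaves-new-point : ∀ {n} (u : Fin (suc n)) (g : Fin (suc n) → Fin (suc n)) {z z′} →
  g u ≡ punchIn u z → g (punchIn u z) ≡ punchIn u z′ → g (g u) ≢ u
leaves-new-point u g {z} {z′} gu g² back =
  punchInᵢ≢i u z′ (trans (sym g²) (trans (cong g (sym gu)) back))

other-index : ∀ j t → t ≢ j → t ≡ next j ⊎ t ≡ next (next j)
other-index 0F 0F t≢j = ⊥-elim (t≢j refl)
other-index 0F 1F _   = inj₁ refl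
other-index 0F 2F _   = inj₂ refl
other-index 1F 0F _   = inj₂ refl
other-index 1F 1F t≢j = ⊥-elim (t≢j refl)
other-index 1F 2F _   = inj₁ refl
other-index 2F 0F _   = inj₁ refl
other-index 2F 1F _   = inj₂ refl
other-index 2F 2F t≢j = ⊥-elim (t≢j refl)

slide-moves-new-point : ∀ {n} (X : Triple n) → (∀ i a → X i ⟨$⟩ʳ a ≢ a) →
  ∀ x j u t → t ≢ j → slide X x j u t (slide X x j u t u) ≢ u
slide-moves-new-point X fixfree x j u t t≢j with other-index j t t≢j
... | inj₁ refl = leaves-new-point u (slide X x j u (next j))
  (trans (slide-next X x j u u) (extend-new u _ _))
  (trans (slide-next X x j u _) (trans (extend-old u _ _ _) (ifEq-no (fixfree (next j) x))))
... | inj₂ refl = leaves-new-point u (slide X x j u l)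
  (trans (slide-prev X x j u u) (extend-new u _ _))
  (trans (slide-prev X x j u _) (trans (extend-old u _ _ _) (ifEq-no w≢y)))
  where
  l = next (next j)
  w = X j ⟨$⟩ʳ x
  w≢y : w ≢ X l ⟨$⟩ˡ w
  w≢y w≡y = fixfree l w (trans (cong (X l ⟨$⟩ʳ_) w≡y) (inverseʳ (X l)))

third-index : ∀ (i j : Fin 3) → ∃ λ t → t ≢ i × t ≢ j
third-index 0F 0F = 1F , (λ ()) , (λ ())
third-index 0F 1F = 2F , (λ ()) , (λ ())
third-index 0F 2F = 1F , (λ ()) , (λ ())
third-index 1F 0F = 2F , (λ ()) , (λ ())
third-index 1F 1F = 0F , (λ ()) , (λ ())
third-index 1F 2F = 0F , (λ ()) , (λ ())
third-index 2F 0F = 1F , (λ ()) , (λ ())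
third-index 2F 1F = 0F , (λ ()) , (λ ())
third-index 2F 2F = 0F , (λ ()) , (λ ())

mainTheorem2 : ∀ (n : ℕ) (Z : Triple (suc n)) → IsBitrade Z → IsBicyclic Z →
    ∀ (X : Triple n) (x : Fin n) (j : Fin 3) (u : Fin (suc n)) →
      IsBitrade X → IsSpherical X → SlideDefined X x j →
      ¬ (slide X x j u ≐ asMaps Z) × ¬ (slide X x j u ≐ inverseTriple Z)
mainTheorem2 n Z bZ (i , twoCycles) X x j u bX _ _ with third-index i j
... | t , t≢i , t≢j =
  refute (asMaps Z) Zₜ-involution ,
  refute (inverseTriple Z) (inverseTriple-involution Z bZ t Zₜ-involution)
  where
  Zₜ-involution : Involution (asMaps Z t)
  Zₜ-involution = bicyclic⇒involutions Z bZ i (≤-reflexive twoCycles) t t≢i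
  refute : (M : Fin 3 → Fin (suc n) → Fin (suc n)) → Involution (M t) → ¬ (slide X x j u ≐ M)
  refute M Mₜ-involution same =
    slide-moves-new-point X (IsBitrade.T3 bX) x j u t t≢j (begin
      S (S u)      ≡⟨ same t (S u) ⟩
      M t (S u)    ≡⟨ cong (M t) (same t u) ⟩
      M t (M t u)  ≡⟨ Mₜ-involution u ⟩
      u            ∎)
    where
    open ≡-Reasoning
    S = slide X x j u t
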